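{- Let $t$ be a positive integer and $(a_1,b_1),\dots,(a_t,b_t)$ be $t$ couples of positive integers. For $X\subset\mathbb{Z}$ define $\Gamma_0(X)=X$ and, for $1\le s\le t$, $\Gamma_s(X)=a_s\Gamma_{s-1}(X)-b_s\Gamma_{s-1}(X)$. Then there exists a set $A$ of positive integers whose asymptotic density $d(A)=\lim_{n\to\infty}|A\cap\{1,\dots,n\}|/n$ exists and equals $\prod_{i=1}^t\frac{1}{a_i+b_i}$, such that the family $\{\Gamma_s(A)\mid 0\le s\le t\}$ has cardinality $t+1$ (i.e. the sets $\Gamma_0(A),\dots,\Gamma_t(A)$ are pairwise distinct).
   Context: For $X\subset\mathbb{Z}$ and integers $a,b$, $aX-bX=\{ax-bx'\mid x,x'\in X\}$. The set $\Gamma_s(X)$ is the paper's composition $\bigcirc_{j=1}^s\Gamma_{a_j,b_j}(X)$ of the linear operations $\Gamma_{a_j,b_j}(X)=a_jX-b_jX$, with the convention that for $s=0$ it is $X$. -}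

module Defs where

open import Data.Nat as ℕ using (ℕ; zero; suc)
open import Data.Integer as ℤ using (ℤ; +_)
open import Data.Rational as ℚ using (ℚ)
open import Data.Bool using (Bool; true; false)
open import Data.Product using (Σ; ∃; _×_; _,_)
open import Relation.Binary.PropositionalEquality using (_≡_)
open import Level using (0ℓ)
open import Relation.Unary using (Pred)

ℤSet : Set₁
ℤSet = Pred ℤ 0ℓ

Γlin : ℕ → ℕ → ℤSet → ℤSet
Γlin a b X z = ∃ λ x → ∃ λ x' → X x × X x' × (z ≡ (+ a) ℤ.* x ℤ.- (+ b) ℤ.* x')

Γ : (a b : ℕ → ℕ) → ℕ → ℤSet → ℤSet
Γ a b zero    X = X
Γ a b (suc s) X = Γlin (a (suc s)) (b (suc s)) (Γ a b s X)

toℤSet : (ℕ → Bool) → ℤSet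
toℤSet A z = ∃ λ k → (z ≡ + k) × (A k ≡ true)

-- Reciprocal 1/n for n ≥ 1 (value at 0 is irrelevant, set to 0).
inv : ℕ → ℚ
inv zero    = ℚ.0ℚ
inv (suc n) = (+ 1) ℚ./ suc n

densProd : (a b : ℕ → ℕ) → ℕ → ℚ
densProd a b zero    = ℚ.1ℚ
densProd a b (suc s) = densProd a b s ℚ.* inv (a (suc s) ℕ.+ b (suc s))

count : (ℕ → Bool) → ℕ → ℕ
count A zero = 0
count A (suc n) with A (suc n)
... | true  = suc (count A n)
... | false = count A n

HasDensity : (ℕ → Bool) → ℚ → Set
HasDensity A d = ∀ (ε : ℚ) → ℚ.0ℚ ℚ.< ε →
  ∃ λ N → ∀ n → N ℕ.≤ n → ℚ.∣ (inv (suc n) ℚ.* ((+ count A (suc n)) ℚ./ 1)) ℚ.- d ∣ ℚ.< ε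

module Submission where

-- Put M = ∏_{i ≤ t} (a_i + b_i) and N = 3M, and let A be the set of positive
-- integers congruent to -1, 0 or 1 modulo N.  A is N-periodic with three elements per
-- period, so its density is 3/N = 1/M, the required product.  Writing H_s = ∏_{i ≤ s} (a_i + b_i)
-- (so H_0 = 1, H_t = M):
--   * upper bound: every element of Γ_s(A) lies within H_s of a multiple of N, since
--     Γ_{a,b} multiplies the distance to the multiples of N by at most a + b;
--   * lower bound: Γ_s(A) contains every ±H_s + N L_s c (c ≥ 1, L_s = ∏_{i ≤ s} a_i b_i),
--     and in particular H_s itself when s ≥ 1.
-- H is strictly increasing and H_j + H_i ≤ 2M < N, so for i < j the integer H_j lies in
-- Γ_j(A) but not in Γ_i(A).

open import Defs
open import Data.Nat using (ℕ; zero; suc; _+_; _*_; _∸_; _≤_; _<_; z≤n; s≤s; _<ᵇ_; NonZero)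
import Data.Nat.Properties as ℕP
open import Data.Nat.DivMod using (_%_; _/_; m≡m%n+[m/n]*n; m%n<n; m<n⇒m%n≡m; [m+n]%n≡m%n; [m+kn]%n≡m%n; m*n%n≡0; n%n≡0)
import Data.Nat.Tactic.RingSolver as ℕSolver
open import Data.Integer as ℤ using (ℤ; +_; +[1+_]; -[1+_]; _⊖_)
import Data.Integer.Properties as ℤP
open import Data.Integer.Tactic.RingSolver using (solve-∀)
open import Data.Rational as ℚ using (ℚ; mkℚ)
import Data.Rational.Properties as ℚP
open import Data.Rational.Unnormalised as Q using (ℚᵘ; mkℚᵘ)
import Data.Rational.Unnormalised.Properties as QP
open import Data.Bool using (Bool; true; false; T)
open import Data.Product using (∃; ∃₂; _×_; _,_; proj₁; proj₂; uncurry)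
open import Data.Sum using (inj₁; inj₂)
open import Data.Empty using (⊥; ⊥-elim)
open import Relation.Nullary using (¬_)
open import Relation.Binary using (tri<; tri≈; tri>)
open import Relation.Binary.PropositionalEquality

PositiveCouples : (a b : ℕ → ℕ) → ℕ → Set
PositiveCouples a b t = ∀ i → 1 ≤ i → i ≤ t → (1 ≤ a i) × (1 ≤ b i)

Near : ℕ → ℕ → ℤ → Set
Near N h z = ∃₂ λ m e → (z ≡ + N ℤ.* m ℤ.+ e) × (ℤ.∣ e ∣ ≤ h)

-- Γ_{a,b} multiplies the distance to the multiples of N by at most a + b:
-- a(Nm + e) - b(Nm' + e') = N(am - bm') + (ae - be').
near-Γlin : ∀ {N h x x'} a b → Near N h x → Near N h x' →
  Near N ((a + b) * h) (+ a ℤ.* x ℤ.- + b ℤ.* x')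
near-Γlin {N} {h} a b (m , e , refl , ∣e∣≤h) (m' , e' , refl , ∣e'∣≤h) =
  + a ℤ.* m ℤ.- + b ℤ.* m' , + a ℤ.* e ℤ.- + b ℤ.* e' , regroup (+ a) (+ b) (+ N) m e m' e' , bound
  where
  regroup : ∀ (A B N m e m' e' : ℤ) →
    A ℤ.* (N ℤ.* m ℤ.+ e) ℤ.- B ℤ.* (N ℤ.* m' ℤ.+ e') ≡ N ℤ.* (A ℤ.* m ℤ.- B ℤ.* m') ℤ.+ (A ℤ.* e ℤ.- B ℤ.* e')
  regroup = solve-∀
  open ℕP.≤-Reasoning
  bound : ℤ.∣ + a ℤ.* e ℤ.- + b ℤ.* e' ∣ ≤ (a + b) * h
  bound = begin
    ℤ.∣ + a ℤ.* e ℤ.- + b ℤ.* e' ∣         ≤⟨ ℤP.∣i-j∣≤∣i∣+∣j∣ (+ a ℤ.* e) (+ b ℤ.* e') ⟩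
    ℤ.∣ + a ℤ.* e ∣ + ℤ.∣ + b ℤ.* e' ∣     ≡⟨ cong₂ _+_ (ℤP.abs-* (+ a) e) (ℤP.abs-* (+ b) e') ⟩
    a * ℤ.∣ e ∣ + b * ℤ.∣ e' ∣             ≤⟨ ℕP.+-mono-≤ (ℕP.*-monoʳ-≤ a ∣e∣≤h) (ℕP.*-monoʳ-≤ b ∣e'∣≤h) ⟩
    a * h + b * h                          ≡⟨ ℕP.*-distribʳ-+ h a b ⟨
    (a + b) * h                            ∎

-- A positive integer h is not within k < h of a multiple of N when h + k < N: the
-- multiple 0 is more than k below h, and every nonzero multiple is more than k away.
not-near : ∀ {N h k} → k < h → h + k < N → ¬ Near N k (+ h)
not-near {N} {h} {k} k<h h+k<N (m , e , h≡ , ∣e∣≤k) = by-size ℤ.∣ m ∣ refl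
  where
  open ℕP.≤-Reasoning
  cancel : ∀ (x e : ℤ) → x ℤ.+ e ℤ.- e ≡ x
  cancel = solve-∀
  by-size : ∀ u → ℤ.∣ m ∣ ≡ u → ⊥
  by-size zero ∣m∣≡0 = ℕP.<⇒≱ k<h (begin
    ℤ.∣ + h ∣                       ≡⟨ cong ℤ.∣_∣ h≡ ⟩
    ℤ.∣ + N ℤ.* m ℤ.+ e ∣           ≤⟨ ℤP.∣i+j∣≤∣i∣+∣j∣ (+ N ℤ.* m) e ⟩
    ℤ.∣ + N ℤ.* m ∣ + ℤ.∣ e ∣       ≡⟨ cong (_+ ℤ.∣ e ∣) (trans (ℤP.abs-* (+ N) m) (cong (N *_) ∣m∣≡0)) ⟩
    N * 0 + ℤ.∣ e ∣                 ≡⟨ cong (_+ ℤ.∣ e ∣) (ℕP.*-zeroʳ N) ⟩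
    ℤ.∣ e ∣                         ≤⟨ ∣e∣≤k ⟩
    k                               ∎)
  by-size (suc u) ∣m∣≡1+u = ℕP.<⇒≱ h+k<N (begin
    N                               ≤⟨ ℕP.m≤m*n N (suc u) ⟩
    N * suc u                       ≡⟨ trans (ℤP.abs-* (+ N) m) (cong (N *_) ∣m∣≡1+u) ⟨
    ℤ.∣ + N ℤ.* m ∣                 ≡⟨ cong ℤ.∣_∣ (trans (cong (ℤ._- e) h≡) (cancel (+ N ℤ.* m) e)) ⟨
    ℤ.∣ + h ℤ.- e ∣                 ≤⟨ ℤP.∣i-j∣≤∣i∣+∣j∣ (+ h) e ⟩
    h + ℤ.∣ e ∣                     ≤⟨ ℕP.+-monoʳ-≤ h ∣e∣≤k ⟩
    h + k                           ∎)

Reaches : ℕ → ℕ → ℕ → ℤSet → Set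
Reaches N h L Y = ∀ c → 1 ≤ c →
  Y (+ h ℤ.+ + N ℤ.* (+ L ℤ.* + c)) × Y (ℤ.- + h ℤ.+ + N ℤ.* (+ L ℤ.* + c))

-- Γ_{a,b} propagates this: ±(a+b)h + N(abL)c = a(±h + NL(2bc)) - b(∓h + NL(ac)).
reaches-Γlin : ∀ {N h L Y} a b → (1 ≤ a) × (1 ≤ b) → Reaches N h L Y →
  Reaches N ((a + b) * h) (a * b * L) (Γlin a b Y)
reaches-Γlin {N} {h} {L} a b (1≤a , 1≤b) reach c 1≤c =
    (_ , _ , proj₁ (reach c₁ 1≤c₁) , proj₂ (reach c₂ 1≤c₂) , expand (λ x → x) ℤ.-_ split₊)
  , (_ , _ , proj₂ (reach c₁ 1≤c₁) , proj₁ (reach c₂ 1≤c₂) , expand ℤ.-_ (λ x → x) split₋)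
  where
  c₁ c₂ : ℕ
  c₁ = b * (c + c)
  c₂ = a * c
  1≤c₁ : 1 ≤ c₁
  1≤c₁ = ℕP.*-mono-≤ 1≤b (ℕP.≤-trans 1≤c (ℕP.m≤m+n c c))
  1≤c₂ : 1 ≤ c₂
  1≤c₂ = ℕP.*-mono-≤ 1≤a 1≤c
  split₊ : ∀ (A B H N L C : ℤ) →
    (A ℤ.+ B) ℤ.* H ℤ.+ N ℤ.* (A ℤ.* B ℤ.* L ℤ.* C) ≡
    A ℤ.* (H ℤ.+ N ℤ.* (L ℤ.* (B ℤ.* (C ℤ.+ C)))) ℤ.- B ℤ.* (ℤ.- H ℤ.+ N ℤ.* (L ℤ.* (A ℤ.* C)))
  split₊ = solve-∀
  split₋ : ∀ (A B H N L C : ℤ) →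
    ℤ.- ((A ℤ.+ B) ℤ.* H) ℤ.+ N ℤ.* (A ℤ.* B ℤ.* L ℤ.* C) ≡
    A ℤ.* (ℤ.- H ℤ.+ N ℤ.* (L ℤ.* (B ℤ.* (C ℤ.+ C)))) ℤ.- B ℤ.* (H ℤ.+ N ℤ.* (L ℤ.* (A ℤ.* C)))
  split₋ = solve-∀
  sum≡ : + ((a + b) * h) ≡ (+ a ℤ.+ + b) ℤ.* + h
  sum≡ = trans (ℤP.pos-* (a + b) h) (cong (ℤ._* + h) (ℤP.pos-+ a b))
  prod≡ : + (a * b * L) ≡ + a ℤ.* + b ℤ.* + L
  prod≡ = trans (ℤP.pos-* (a * b) L) (cong (ℤ._* + L) (ℤP.pos-* a b))
  c₁≡ : + c₁ ≡ + b ℤ.* (+ c ℤ.+ + c)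
  c₁≡ = trans (ℤP.pos-* b (c + c)) (cong (+ b ℤ.*_) (ℤP.pos-+ c c))
  c₂≡ : + c₂ ≡ + a ℤ.* + c
  c₂≡ = ℤP.pos-* a c
  -- σ and τ are the signs (identity or negation) in front of h in the two witnesses
  expand : ∀ (σ τ : ℤ → ℤ) →
    (∀ (A B H N L C : ℤ) →
      σ ((A ℤ.+ B) ℤ.* H) ℤ.+ N ℤ.* (A ℤ.* B ℤ.* L ℤ.* C) ≡
      A ℤ.* (σ H ℤ.+ N ℤ.* (L ℤ.* (B ℤ.* (C ℤ.+ C)))) ℤ.- B ℤ.* (τ H ℤ.+ N ℤ.* (L ℤ.* (A ℤ.* C)))) →
    σ (+ ((a + b) * h)) ℤ.+ + N ℤ.* (+ (a * b * L) ℤ.* + c) ≡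
    + a ℤ.* (σ (+ h) ℤ.+ + N ℤ.* (+ L ℤ.* + c₁)) ℤ.- + b ℤ.* (τ (+ h) ℤ.+ + N ℤ.* (+ L ℤ.* + c₂))
  expand σ τ identity = begin
    σ (+ ((a + b) * h)) ℤ.+ + N ℤ.* (+ (a * b * L) ℤ.* + c)
      ≡⟨ cong₂ (λ u v → σ u ℤ.+ + N ℤ.* (v ℤ.* + c)) sum≡ prod≡ ⟩
    σ ((+ a ℤ.+ + b) ℤ.* + h) ℤ.+ + N ℤ.* (+ a ℤ.* + b ℤ.* + L ℤ.* + c)
      ≡⟨ identity (+ a) (+ b) (+ h) (+ N) (+ L) (+ c) ⟩
    + a ℤ.* (σ (+ h) ℤ.+ + N ℤ.* (+ L ℤ.* (+ b ℤ.* (+ c ℤ.+ + c)))) ℤ.- + b ℤ.* (τ (+ h) ℤ.+ + N ℤ.* (+ L ℤ.* (+ a ℤ.* + c)))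
      ≡⟨ cong₂ (λ u v → + a ℤ.* (σ (+ h) ℤ.+ + N ℤ.* (+ L ℤ.* u)) ℤ.- + b ℤ.* (τ (+ h) ℤ.+ + N ℤ.* (+ L ℤ.* v))) c₁≡ c₂≡ ⟨
    + a ℤ.* (σ (+ h) ℤ.+ + N ℤ.* (+ L ℤ.* + c₁)) ℤ.- + b ℤ.* (τ (+ h) ℤ.+ + N ℤ.* (+ L ℤ.* + c₂))
      ∎
    where open ≡-Reasoning

-- In particular (a+b)h = a(h + NLb) - b(-h + NLa) belongs to Γ_{a,b}(Y).
reached-height : ∀ {N h L Y} a b → (1 ≤ a) × (1 ≤ b) → Reaches N h L Y →
  Γlin a b Y (+ ((a + b) * h))
reached-height {N} {h} {L} a b (1≤a , 1≤b) reach =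
  _ , _ , proj₁ (reach b 1≤b) , proj₂ (reach a 1≤a) , (begin
    + ((a + b) * h)                      ≡⟨ trans (ℤP.pos-* (a + b) h) (cong (ℤ._* + h) (ℤP.pos-+ a b)) ⟩
    (+ a ℤ.+ + b) ℤ.* + h                ≡⟨ split (+ a) (+ b) (+ h) (+ N) (+ L) ⟩
    + a ℤ.* (+ h ℤ.+ + N ℤ.* (+ L ℤ.* + b)) ℤ.- + b ℤ.* (ℤ.- + h ℤ.+ + N ℤ.* (+ L ℤ.* + a)) ∎)
  where
  open ≡-Reasoning
  split : ∀ (A B H N L : ℤ) →
    (A ℤ.+ B) ℤ.* H ≡ A ℤ.* (H ℤ.+ N ℤ.* (L ℤ.* B)) ℤ.- B ℤ.* (ℤ.- H ℤ.+ N ℤ.* (L ℤ.* A))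
  split = solve-∀

-- H_s = ∏_{i ≤ s} (a_i + b_i): the distance bound for Γ_s, and the integer separating Γ_s.
height : (a b : ℕ → ℕ) → ℕ → ℕ
height a b zero    = 1
height a b (suc s) = (a (suc s) + b (suc s)) * height a b s

-- L_s = ∏_{i ≤ s} a_i b_i: the step of the progressions ±H_s + N L_s c inside Γ_s.
scale : (a b : ℕ → ℕ) → ℕ → ℕ
scale a b zero    = 1
scale a b (suc s) = a (suc s) * b (suc s) * scale a b s

Γ-near : ∀ N a b (X : ℤSet) → (∀ z → X z → Near N 1 z) →
  ∀ s z → Γ a b s X z → Near N (height a b s) z
Γ-near N a b X near zero    z z∈X = near z z∈X
Γ-near N a b X near (suc s) z (x , x' , x∈ , x'∈ , refl) =
  near-Γlin {N} (a (suc s)) (b (suc s)) (Γ-near N a b X near s x x∈) (Γ-near N a b X near s x' x'∈)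

Γ-reaches : ∀ N t a b (X : ℤSet) → PositiveCouples a b t → Reaches N 1 1 X →
  ∀ s → s ≤ t → Reaches N (height a b s) (scale a b s) (Γ a b s X)
Γ-reaches N t a b X positive reach zero    _   = reach
Γ-reaches N t a b X positive reach (suc s) s<t =
  reaches-Γlin {N} {height a b s} {scale a b s} (a (suc s)) (b (suc s)) (positive (suc s) (s≤s z≤n) s<t)
    (Γ-reaches N t a b X positive reach s (ℕP.<⇒≤ s<t))

height-∈-Γ : ∀ N t a b (X : ℤSet) → PositiveCouples a b t → Reaches N 1 1 X →
  ∀ s → suc s ≤ t → Γ a b (suc s) X (+ height a b (suc s))
height-∈-Γ N t a b X positive reach s s<t =
  reached-height {N} {height a b s} {scale a b s} (a (suc s)) (b (suc s)) (positive (suc s) (s≤s z≤n) s<t)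
    (Γ-reaches N t a b X positive reach s (ℕP.<⇒≤ s<t))

module Heights {t : ℕ} {a b : ℕ → ℕ} (positive : PositiveCouples a b t) where

  couple-sum : ∀ s → suc s ≤ t → 2 ≤ a (suc s) + b (suc s)
  couple-sum s s<t = uncurry ℕP.+-mono-≤ (positive (suc s) (s≤s z≤n) s<t)

  height-pos : ∀ s → s ≤ t → 1 ≤ height a b s
  height-pos zero    _   = s≤s z≤n
  height-pos (suc s) s<t =
    ℕP.*-mono-≤ (ℕP.≤-trans (s≤s z≤n) (couple-sum s s<t)) (height-pos s (ℕP.<⇒≤ s<t))

  height-grows : ∀ s → suc s ≤ t → height a b s < height a b (suc s)
  height-grows s s<t = begin-strict
    h                               <⟨ ℕP.m<m+n h (height-pos s (ℕP.<⇒≤ s<t)) ⟩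
    h + h                           ≡⟨ cong (λ k → h + k) (ℕP.+-identityʳ h) ⟨
    2 * h                           ≤⟨ ℕP.*-monoˡ-≤ h (couple-sum s s<t) ⟩
    (a (suc s) + b (suc s)) * h     ∎
    where
    open ℕP.≤-Reasoning
    h : ℕ
    h = height a b s

  height-mono : ∀ {i j} → i ≤ j → j ≤ t → height a b i ≤ height a b j
  height-mono {j = zero}  z≤n _ = ℕP.≤-refl
  height-mono {i} {suc j} i≤j j<t with ℕP.m≤n⇒m<n∨m≡n i≤j
  ... | inj₂ refl      = ℕP.≤-refl
  ... | inj₁ (s≤s i≤j) = ℕP.≤-trans (height-mono i≤j (ℕP.<⇒≤ j<t)) (ℕP.<⇒≤ (height-grows j j<t))

  height-strict : ∀ {i j} → i < j → j ≤ t → height a b i < height a b j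
  height-strict {i} i<j j≤t = ℕP.<-≤-trans (height-grows i (ℕP.≤-trans i<j j≤t)) (height-mono i<j j≤t)

Γ-separated : ∀ N t a b (X : ℤSet) → PositiveCouples a b t →
  (∀ z → X z → Near N 1 z) → Reaches N 1 1 X → height a b t + height a b t < N →
  ∀ i j → i < j → j ≤ t → ¬ (∀ z → Γ a b j X z → Γ a b i X z)
Γ-separated N t a b X positive near reach wide i (suc s) i<j j≤t Γj⊆Γi =
  not-near (height-strict i<j j≤t) close
    (Γ-near N a b X near i _ (Γj⊆Γi _ (height-∈-Γ N t a b X positive reach s j≤t)))
  where
  open Heights positive
  close : height a b (suc s) + height a b i < N
  close = ℕP.≤-<-trans (ℕP.+-mono-≤ (height-mono j≤t ℕP.≤-refl)
                                     (height-mono (ℕP.≤-trans (ℕP.<⇒≤ i<j) j≤t) ℕP.≤-refl)) wide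

pairwise-distinct : ∀ t (F : ℕ → ℤSet) → (∀ i j → i < j → j ≤ t → ¬ (∀ z → F j z → F i z)) →
  ∀ i j → i ≤ t → j ≤ t → ¬ (i ≡ j) → ¬ (∀ z → (F i z → F j z) × (F j z → F i z))
pairwise-distinct t F later⊈earlier i j i≤t j≤t i≢j same with ℕP.<-cmp i j
... | tri< i<j _ _ = later⊈earlier i j i<j j≤t (λ z → proj₂ (same z))
... | tri≈ _ i≡j _ = i≢j i≡j
... | tri> _ _ j<i = later⊈earlier j i j<i i≤t (λ z → proj₁ (same z))

count-true : ∀ (A : ℕ → Bool) n → A (suc n) ≡ true → count A (suc n) ≡ suc (count A n)
count-true A n n+1∈A with A (suc n)
... | true = refl

count-false : ∀ (A : ℕ → Bool) n → A (suc n) ≡ false → count A (suc n) ≡ count A n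
count-false A n n+1∉A with A (suc n)
... | false = refl

count-step : ∀ (A : ℕ → Bool) m n k → A (suc m) ≡ A (suc n) →
  count A m ≡ k + count A n → count A (suc m) ≡ k + count A (suc n)
count-step A m n k same eq with A (suc m) | A (suc n)
... | true  | true  = trans (cong suc eq) (sym (ℕP.+-suc k (count A n)))
... | false | false = eq

count-mono : ∀ (A : ℕ → Bool) {m n} → m ≤ n → count A m ≤ count A n
count-mono A {n = zero}  z≤n = ℕP.≤-refl
count-mono A {m} {suc n} m≤n+1 with ℕP.m≤n⇒m<n∨m≡n m≤n+1
... | inj₂ refl      = ℕP.≤-refl
... | inj₁ (s≤s m≤n) = ℕP.≤-trans (count-mono A m≤n) (one-step n)
  where
  one-step : ∀ n → count A n ≤ count A (suc n)
  one-step n with A (suc n)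
  ... | true  = ℕP.n≤1+n (count A n)
  ... | false = ℕP.≤-refl

∣⊖∣≤ : ∀ x y {K} → x ≤ y + K → y ≤ x + K → ℤ.∣ x ⊖ y ∣ ≤ K
∣⊖∣≤ x y x≤y+K y≤x+K with ℕP.≤-total x y
... | inj₁ x≤y = ℕP.≤-trans (ℕP.≤-reflexive (ℤP.∣⊖∣-≤ x≤y)) (ℕP.m≤n+o⇒m∸n≤o y x y≤x+K)
... | inj₂ y≤x = ℕP.≤-trans (ℕP.≤-reflexive (trans (ℤP.∣m⊖n∣≡∣n⊖m∣ x y) (ℤP.∣⊖∣-≤ y≤x)))
                            (ℕP.m≤n+o⇒m∸n≤o x y x≤y+K)

module Periodic (A : ℕ → Bool) (N : ℕ) (periodic : ∀ n → A (suc (N + n)) ≡ A (suc n)) where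

  count-shift : ∀ n → count A (N + n) ≡ count A N + count A n
  count-shift zero    = trans (cong (count A) (ℕP.+-identityʳ N)) (sym (ℕP.+-identityʳ (count A N)))
  count-shift (suc n) = trans (cong (count A) (ℕP.+-suc N n))
                              (count-step A (N + n) n (count A N) (periodic n) (count-shift n))

  count-periods : ∀ q r → count A (q * N + r) ≡ q * count A N + count A r
  count-periods zero    r = refl
  count-periods (suc q) r = begin
    count A (N + q * N + r)                    ≡⟨ cong (count A) (ℕP.+-assoc N (q * N) r) ⟩
    count A (N + (q * N + r))                  ≡⟨ count-shift (q * N + r) ⟩
    count A N + count A (q * N + r)            ≡⟨ cong (λ k → count A N + k) (count-periods q r) ⟩
    count A N + (q * count A N + count A r)    ≡⟨ ℕP.+-assoc (count A N) _ _ ⟨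
    count A N + q * count A N + count A r      ∎
    where open ≡-Reasoning

  discrepancy : ∀ M .{{_ : NonZero N}} → count A N * M ≡ N → ∀ n → ℤ.∣ count A n * M ⊖ n ∣ ≤ N
  discrepancy M period-count n = ∣⊖∣≤ (count A n * M) n upper lower
    where
    q r : ℕ
    q = n / N
    r = n % N
    r≤N : r ≤ N
    r≤N = ℕP.<⇒≤ (m%n<n n N)
    n≡ : n ≡ q * N + r
    n≡ = trans (m≡m%n+[m/n]*n n N) (ℕP.+-comm r (q * N))
    scaled : count A n * M ≡ q * N + count A r * M
    scaled = begin
      count A n * M                            ≡⟨ cong (λ k → count A k * M) n≡ ⟩
      count A (q * N + r) * M                  ≡⟨ cong (_* M) (count-periods q r) ⟩
      (q * count A N + count A r) * M          ≡⟨ ℕP.*-distribʳ-+ M (q * count A N) (count A r) ⟩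
      q * count A N * M + count A r * M        ≡⟨ cong (_+ count A r * M) (ℕP.*-assoc q (count A N) M) ⟩
      q * (count A N * M) + count A r * M      ≡⟨ cong (λ k → q * k + count A r * M) period-count ⟩
      q * N + count A r * M                    ∎
      where open ≡-Reasoning
    rest≤N : count A r * M ≤ N
    rest≤N = ℕP.≤-trans (ℕP.*-monoˡ-≤ M (count-mono A r≤N)) (ℕP.≤-reflexive period-count)
    open ℕP.≤-Reasoning
    upper : count A n * M ≤ n + N
    upper = begin
      count A n * M                  ≡⟨ scaled ⟩
      q * N + count A r * M          ≤⟨ ℕP.+-monoʳ-≤ (q * N) rest≤N ⟩
      q * N + N                      ≤⟨ ℕP.+-monoˡ-≤ N (ℕP.m≤m+n (q * N) r) ⟩
      q * N + r + N                  ≡⟨ cong (_+ N) n≡ ⟨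
      n + N                          ∎
    lower : n ≤ count A n * M + N
    lower = begin
      n                              ≡⟨ n≡ ⟩
      q * N + r                      ≤⟨ ℕP.+-monoʳ-≤ (q * N) r≤N ⟩
      q * N + N                      ≤⟨ ℕP.+-monoˡ-≤ N (ℕP.m≤m+n (q * N) (count A r * M)) ⟩
      q * N + count A r * M + N      ≡⟨ cong (_+ N) scaled ⟨
      count A n * M + N              ∎

relative-error : ℕ → ℕ → ℕ → ℚᵘ
relative-error n c m = mkℚᵘ (+ 1) n Q.* mkℚᵘ (+ c) 0 Q.- mkℚᵘ (+ 1) m

relative-error-≃ : ∀ n c m →
  ℚ.toℚᵘ (ℚ.∣ inv (suc n) ℚ.* (+ c ℚ./ 1) ℚ.- inv (suc m) ∣) Q.≃ Q.∣ relative-error n c m ∣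
relative-error-≃ n c m = begin
  ℚ.toℚᵘ (ℚ.∣ x ℚ.- y ∣)                   ≈⟨ ℚP.toℚᵘ-homo-∣-∣ (x ℚ.- y) ⟩
  Q.∣ ℚ.toℚᵘ (x ℚ.+ ℚ.- y) ∣               ≈⟨ QP.∣-∣-cong (ℚP.toℚᵘ-homo-+ x (ℚ.- y)) ⟩
  Q.∣ ℚ.toℚᵘ x Q.+ ℚ.toℚᵘ (ℚ.- y) ∣        ≈⟨ QP.∣-∣-cong (QP.+-cong x≃ -y≃) ⟩
  Q.∣ relative-error n c m ∣               ∎
  where
  open QP.≃-Reasoning
  x y : ℚ
  x = inv (suc n) ℚ.* (+ c ℚ./ 1)
  y = inv (suc m)
  x≃ : ℚ.toℚᵘ x Q.≃ mkℚᵘ (+ 1) n Q.* mkℚᵘ (+ c) 0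
  x≃ = QP.≃-trans (ℚP.toℚᵘ-homo-* (inv (suc n)) (+ c ℚ./ 1))
         (QP.*-cong (ℚP.toℚᵘ-fromℚᵘ (mkℚᵘ (+ 1) n)) (ℚP.toℚᵘ-fromℚᵘ (mkℚᵘ (+ c) 0)))
  -y≃ : ℚ.toℚᵘ (ℚ.- y) Q.≃ Q.- mkℚᵘ (+ 1) m
  -y≃ = QP.≃-trans (ℚP.toℚᵘ-homo‿- y) (QP.-‿cong (ℚP.toℚᵘ-fromℚᵘ (mkℚᵘ (+ 1) m)))

relative-error-numerator : ∀ n c m → Q.↥ relative-error n c m ≡ c * suc m ⊖ suc n
relative-error-numerator n c m = begin
  (+ 1 ℤ.* + c) ℤ.* + suc m ℤ.+ (ℤ.- + 1) ℤ.* + (suc n * 1)   ≡⟨ simplify (+ c) (+ suc m) (+ (suc n * 1)) ⟩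
  + c ℤ.* + suc m ℤ.- + (suc n * 1)                            ≡⟨ cong₂ ℤ._-_ (sym (ℤP.pos-* c (suc m))) (cong +_ (ℕP.*-identityʳ (suc n))) ⟩
  + (c * suc m) ℤ.- + (suc n)                                  ≡⟨ ℤP.[+m]-[+n]≡m⊖n (c * suc m) (suc n) ⟩
  c * suc m ⊖ suc n                                            ∎
  where
  open ≡-Reasoning
  simplify : ∀ (C M D : ℤ) → (+ 1 ℤ.* C) ℤ.* M ℤ.+ (ℤ.- + 1) ℤ.* D ≡ C ℤ.* M ℤ.- D
  simplify = solve-∀

relative-error-< : ∀ n c m K p d → ℤ.∣ c * suc m ⊖ suc n ∣ ≤ K → K * suc d ≤ n →
  Q.∣ relative-error n c m ∣ Q.< mkℚᵘ +[1+ p ] d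
relative-error-< n c m K p d error≤K n-large =
  Q.*<* (subst₂ ℤ._<_ (ℤP.pos-* ℤ.∣ Q.↥ relative-error n c m ∣ (suc d)) (ℤP.pos-* (suc p) denominator) (ℤ.+<+ cross))
  where
  denominator : ℕ
  denominator = suc n * 1 * suc m
  open ℕP.≤-Reasoning
  cross : ℤ.∣ Q.↥ relative-error n c m ∣ * suc d < suc p * denominator
  cross = begin-strict
    ℤ.∣ Q.↥ relative-error n c m ∣ * suc d   ≡⟨ cong (λ k → ℤ.∣ k ∣ * suc d) (relative-error-numerator n c m) ⟩
    ℤ.∣ c * suc m ⊖ suc n ∣ * suc d          ≤⟨ ℕP.*-monoˡ-≤ (suc d) error≤K ⟩
    K * suc d                                ≤⟨ n-large ⟩
    n                                        <⟨ ℕP.n<1+n n ⟩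
    suc n                                    ≤⟨ ℕP.m≤m*n (suc n) (suc m) ⟩
    suc n * suc m                            ≡⟨ cong (_* suc m) (ℕP.*-identityʳ (suc n)) ⟨
    denominator                              ≤⟨ ℕP.m≤n*m denominator (suc p) ⟩
    suc p * denominator                      ∎

-- A set whose counts satisfy ∣count A n · (m+1) - n∣ ≤ K has density 1/(m+1): for
-- ε = (p+1)/(d+1) every n ≥ K(d+1) works; nonpositive ε contradict 0 < ε.
density-from-discrepancy : ∀ (A : ℕ → Bool) m K →
  (∀ n → ℤ.∣ count A n * suc m ⊖ n ∣ ≤ K) → HasDensity A (inv (suc m))
density-from-discrepancy A m K discrepancy (mkℚ +[1+ p ] d _) _ = K * suc d , λ n n-large →
  ℚP.toℚᵘ-cancel-< (QP.<-respˡ-≃ (QP.≃-sym (relative-error-≃ n (count A (suc n)) m))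
    (relative-error-< n (count A (suc n)) m K p d (discrepancy (suc n)) n-large))
density-from-discrepancy A m K discrepancy ε@(mkℚ (+ 0)    _ _) 0<ε = ⊥-elim (ℤ.Positive.pos (ℚ.positive {ε} 0<ε))
density-from-discrepancy A m K discrepancy ε@(mkℚ -[1+ _ ] _ _) 0<ε = ⊥-elim (ℤ.Positive.pos (ℚ.positive {ε} 0<ε))

inv-* : ∀ {x y} → 1 ≤ x → 1 ≤ y → inv x ℚ.* inv y ≡ inv (x * y)
inv-* {suc h} {suc k} _ _ = ℚP.toℚᵘ-injective (begin
  ℚ.toℚᵘ (inv (suc h) ℚ.* inv (suc k))             ≈⟨ ℚP.toℚᵘ-homo-* (inv (suc h)) (inv (suc k)) ⟩
  ℚ.toℚᵘ (inv (suc h)) Q.* ℚ.toℚᵘ (inv (suc k))    ≈⟨ QP.*-cong (ℚP.toℚᵘ-fromℚᵘ (mkℚᵘ (+ 1) h))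
                                                              (ℚP.toℚᵘ-fromℚᵘ (mkℚᵘ (+ 1) k)) ⟩
  mkℚᵘ (+ 1) h Q.* mkℚᵘ (+ 1) k                    ≈⟨ QP.≃-sym (ℚP.toℚᵘ-fromℚᵘ (mkℚᵘ (+ 1) (k + h * suc k))) ⟩
  ℚ.toℚᵘ (inv (suc h * suc k))                     ∎)
  where open QP.≃-Reasoning

densProd≡inv-height : ∀ {t a b} → PositiveCouples a b t → ∀ s → s ≤ t → densProd a b s ≡ inv (height a b s)
densProd≡inv-height positive zero    _   = refl
densProd≡inv-height {a = a} {b} positive (suc s) s<t = begin
  densProd a b s ℚ.* inv (a (suc s) + b (suc s))        ≡⟨ cong (ℚ._* inv (a (suc s) + b (suc s))) (densProd≡inv-height positive s (ℕP.<⇒≤ s<t)) ⟩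
  inv (height a b s) ℚ.* inv (a (suc s) + b (suc s))    ≡⟨ inv-* (height-pos s (ℕP.<⇒≤ s<t)) (ℕP.≤-trans (s≤s z≤n) (couple-sum s s<t)) ⟩
  inv (height a b s * (a (suc s) + b (suc s)))          ≡⟨ cong inv (ℕP.*-comm (height a b s) _) ⟩
  inv (height a b (suc s))                              ∎
  where
  open ≡-Reasoning
  open Heights positive

-- The set of positive integers k with k ≡ -1, 0 or 1 modulo N = n₀ + 3.
module NearMultiples (n₀ : ℕ) where

  N : ℕ
  N = 3 + n₀

  nearMultiples : ℕ → Bool
  nearMultiples zero    = false
  nearMultiples (suc k) = suc (suc k) % N <ᵇ 3

  near : ∀ z → toℤSet nearMultiples z → Near N 1 z
  near z (suc k , refl , k+1∈) = + q , + r ℤ.- + 1 , shifted , small r r<3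
    where
    r q : ℕ
    r = suc (suc k) % N
    q = suc (suc k) / N
    r<3 : r < 3
    r<3 = ℕP.<ᵇ⇒< r 3 (subst T (sym k+1∈) _)
    small : ∀ r → r < 3 → ℤ.∣ + r ℤ.- + 1 ∣ ≤ 1
    small 0 _ = s≤s z≤n
    small 1 _ = z≤n
    small 2 _ = s≤s z≤n
    small (suc (suc (suc _))) (s≤s (s≤s (s≤s ())))
    division : + 1 ℤ.+ + suc k ≡ + r ℤ.+ + q ℤ.* + N
    division = trans (cong +_ (m≡m%n+[m/n]*n (suc (suc k)) N))
                     (trans (ℤP.pos-+ r (q * N)) (cong (λ x → + r ℤ.+ x) (ℤP.pos-* q N)))
    shifted : + suc k ≡ + N ℤ.* + q ℤ.+ (+ r ℤ.- + 1)
    shifted = begin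
      + suc k                             ≡⟨ unshift (+ suc k) ⟩
      (+ 1 ℤ.+ + suc k) ℤ.- + 1           ≡⟨ cong (ℤ._- + 1) division ⟩
      (+ r ℤ.+ + q ℤ.* + N) ℤ.- + 1       ≡⟨ regroup (+ r) (+ q) (+ N) ⟩
      + N ℤ.* + q ℤ.+ (+ r ℤ.- + 1)       ∎
      where
      open ≡-Reasoning
      unshift : ∀ (x : ℤ) → x ≡ (+ 1 ℤ.+ x) ℤ.- + 1
      unshift = solve-∀
      regroup : ∀ (r q N : ℤ) → (r ℤ.+ q ℤ.* N) ℤ.- + 1 ≡ N ℤ.* q ℤ.+ (r ℤ.- + 1)
      regroup = solve-∀

  reaches : Reaches N 1 1 (toℤSet nearMultiples)
  reaches c@(suc c') _ = (suc (c * N) , cong (λ x → + 1 ℤ.+ x) multiple , above)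
                       , (suc (suc (n₀ + c' * N)) , cong (λ x → ℤ.- + 1 ℤ.+ x) multiple , below)
    where
    multiple : + N ℤ.* (+ 1 ℤ.* + c) ≡ + (c * N)
    multiple = trans (cong (λ x → + N ℤ.* x) (ℤP.*-identityˡ (+ c)))
                     (trans (sym (ℤP.pos-* N c)) (cong +_ (ℕP.*-comm N c)))
    above : nearMultiples (suc (c * N)) ≡ true
    above = cong (_<ᵇ 3) ([m+kn]%n≡m%n 2 c N)
    below : nearMultiples (suc (suc (n₀ + c' * N))) ≡ true
    below = cong (_<ᵇ 3) (m*n%n≡0 c N)

  periodic : ∀ n → nearMultiples (suc (N + n)) ≡ nearMultiples (suc n)
  periodic n = trans (cong (λ k → suc (suc k) % N <ᵇ 3) (ℕP.+-comm N n))
                     (cong (_<ᵇ 3) ([m+n]%n≡m%n (suc (suc n)) N))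

  count-period : count nearMultiples N ≡ 3
  count-period = begin
    count nearMultiples (suc (suc (suc n₀)))       ≡⟨ count-true nearMultiples _ (cong (_<ᵇ 3) ([m+n]%n≡m%n 1 N)) ⟩
    suc (count nearMultiples (suc (suc n₀)))       ≡⟨ cong suc (count-true nearMultiples _ (cong (_<ᵇ 3) (n%n≡0 N))) ⟩
    suc (suc (count nearMultiples (suc n₀)))       ≡⟨ cong (λ k → suc (suc k)) (count-initial n₀ ℕP.≤-refl) ⟩
    3                                              ∎
    where
    open ≡-Reasoning
    count-initial : ∀ r → r ≤ n₀ → count nearMultiples (suc r) ≡ 1
    count-initial zero    _   = refl
    count-initial (suc r) r<n₀ = trans
      (count-false nearMultiples (suc r) (cong (_<ᵇ 3) (m<n⇒m%n≡m (s≤s (s≤s (s≤s r<n₀))))))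
      (count-initial r (ℕP.<⇒≤ r<n₀))

-- With M = H_t = m + 1 and N = 3M, the set of positive k ≡ -1, 0, 1 (mod N) has density
-- 3/N = ∏ 1/(a_i + b_i), and its images Γ_0, …, Γ_t are separated by the heights H_j.
theorem3p1 : (t : ℕ) → 1 ≤ t → (a b : ℕ → ℕ) →
    (∀ i → 1 ≤ i → i ≤ t → (1 ≤ a i) × (1 ≤ b i)) →
    ∃ λ (A : ℕ → Bool) →
    (A 0 ≡ false) ×
    HasDensity A (densProd a b t) ×
    (∀ i j → i ≤ t → j ≤ t → ¬ (i ≡ j) →
    ¬ (∀ z → (Γ a b i (toℤSet A) z → Γ a b j (toℤSet A) z) × (Γ a b j (toℤSet A) z → Γ a b i (toℤSet A) z)))
theorem3p1 t _ a b positive = nearMultiples , refl , density ,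
  pairwise-distinct t (λ s → Γ a b s (toℤSet nearMultiples))
    (Γ-separated N t a b (toℤSet nearMultiples) positive near reaches wide)
  where
  open Heights positive
  m : ℕ
  m = height a b t ∸ 1
  M≡ : suc m ≡ height a b t
  M≡ = ℕP.m+[n∸m]≡n (height-pos t ℕP.≤-refl)
  open NearMultiples (3 * m)
  open Periodic nearMultiples N periodic
  density : HasDensity nearMultiples (densProd a b t)
  density = subst (HasDensity nearMultiples)
    (sym (trans (densProd≡inv-height positive t ℕP.≤-refl) (cong inv (sym M≡))))
    (density-from-discrepancy nearMultiples m N
      (discrepancy (suc m) (trans (cong (_* suc m) count-period) (ℕP.*-suc 3 m))))
  wide : height a b t + height a b t < N
  wide = subst (λ M → M + M < N) M≡ (ℕP.≤-trans (ℕP.m≤m+n _ m) (ℕP.≤-reflexive (three-halves m)))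
    where
    three-halves : ∀ m → suc (suc m + suc m) + m ≡ 3 + 3 * m
    three-halves = ℕSolver.solve-∀
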